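{- Let $G$ be a nontrivial cyclic group of order $n$ and $\Gamma(G)$ its generator graph. Then $\mathrm{diam}(\Gamma(G)) = 1$ if $n$ is prime, and $\mathrm{diam}(\Gamma(G)) = 2$ otherwise.
   Context: For a group $G$, the generator graph $\Gamma(G)$ is the simple undirected graph whose vertex set is the set of elements of $G$, in which two distinct elements $x,y$ are adjacent if and only if at least one of them generates $G$ (i.e. $\langle x\rangle = G$ or $\langle y\rangle = G$). The diameter of a connected graph is the maximum distance (length of a shortest path) between two of its vertices. -}

module Defs where

open import Level using (Level; _⊔_)
open import Algebra.Bundles using (Group)
open import Data.Nat using (ℕ; zero; suc; _≤_)
open import Data.Fin using (Fin)
open import Data.Product using (Σ; ∃; _×_; _,_)
open import Data.Sum using (_⊎_)
open import Relation.Nullary using (¬_)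
open import Relation.Binary.PropositionalEquality using (_≡_)

module _ {c ℓ : Level} (G : Group c ℓ) where
  open Group G

  pow : Carrier → ℕ → Carrier
  pow x zero    = ε
  pow x (suc k) = x ∙ pow x k

  -- ⟨ x ⟩ = G : every element is an integer power of x
  -- (x^k with k ≥ 0, or x^(-k) = (x⁻¹)^k)
  Generates : Carrier → Set (c ⊔ ℓ)
  Generates x = ∀ y → ∃ λ (k : ℕ) → (y ≈ pow x k) ⊎ (y ≈ pow (x ⁻¹) k)

  Cyclic : Set (c ⊔ ℓ)
  Cyclic = ∃ λ g → Generates g

  HasOrder : ℕ → Set (c ⊔ ℓ)
  HasOrder n = Σ (Fin n → Carrier) λ e →
                 (∀ i j → e i ≈ e j → i ≡ j) × (∀ x → ∃ λ i → e i ≈ x)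

  Adj : Carrier → Carrier → Set (c ⊔ ℓ)
  Adj x y = (¬ (x ≈ y)) × (Generates x ⊎ Generates y)

  data Walk : Carrier → Carrier → ℕ → Set (c ⊔ ℓ) where
    stop : ∀ {x y} → x ≈ y → Walk x y zero
    step : ∀ {x y z k} → Adj x y → Walk y z k → Walk x z (suc k)

  Diameter : ℕ → Set (c ⊔ ℓ)
  Diameter D = (∀ x y → ∃ λ k → k ≤ D × Walk x y k)
             × (∃ λ x → ∃ λ y → ∀ k → Walk x y k → D ≤ k)

{-# OPTIONS --safe #-}
-- Let g generate G. By pigeonhole g^m = ε for some 0 < m ≤ n, and then every
-- element is one of g^0, …, g^(m-1), so n ≤ m and m = n: exponents of g live modulo n.
-- As g is adjacent to every other vertex, the diameter is at most 2. For n prime,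
-- Bézout for r and n shows that every g^r ≠ ε generates, so distinct vertices are
-- adjacent. For a proper divisor d of n, every power of g^d is some g^j with
-- d ∣ j, and g^j = g would force j ≡ 1 modulo n, hence modulo d; so neither
-- ε = g^0 nor g^d generates and these two distinct vertices are at distance 2.

module Submission where

open import Defs
open import Level using (Level)
open import Algebra.Bundles using (Group)
open import Data.Nat using (ℕ; _≤_)
open import Data.Nat.Primality using (Prime)
open import Data.Product using (_×_)
open import Relation.Nullary using (¬_)

open import Data.Fin using (Fin; zero; suc; toℕ; fromℕ<)
import Data.Fin as Fin
open import Data.Fin.Properties using (nonZeroIndex; pigeonhole; injective⇒≤; toℕ-fromℕ<; toℕ<n; toℕ≤pred[n])
open import Data.Nat using (zero; suc; pred; _+_; _*_; _∸_; _<_; _%_; _/_; z≤n; s≤s; NonZero; NonTrivial; >-nonZero; ≢-nonZero⁻¹; nonTrivial⇒nonZero; n>1⇒nonTrivial; nonTrivial⇒n>1)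
open import Data.Nat.Properties using (n<1+n; ≤-total; ≤-antisym; ≤-trans; ≤-<-trans; <⇒≱; m∸n≤m; m∸n≡0⇒m≤n; m+[n∸m]≡n; m<n⇒0<n∸m; <⇒≤; suc-pred; *-comm)
open import Data.Nat.DivMod using (m≡m%n+[m/n]*n; m%n<n; m<n⇒m%n≡m; m∣n⇒o%n%m≡o%m)
open import Data.Nat.Divisibility using (_∣_; ∣-refl; _∣0; ∣n⇒∣m*n; n∣m⇒m%n≡0)
open import Data.Nat.Coprimality as Coprimality using (Coprime; coprime-Bézout; prime⇒coprime)
open import Data.Nat.GCD using (module Bézout)
open import Data.Nat.Primality using (composite; ¬prime⇒composite)
open import Data.Product using (∃; _,_; proj₁; proj₂)
open import Data.Sum using (inj₁; inj₂)
open import Function using (_∘_)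
open import Relation.Binary.Definitions using (Decidable)
open import Relation.Nullary using (yes; no; contradiction)
open import Relation.Binary.PropositionalEquality as ≡ using (_≡_)

%≡%⇒%≡%-divisor : ∀ {d n} a b .{{_ : NonZero d}} .{{_ : NonZero n}} →
                   d ∣ n → a % n ≡ b % n → a % d ≡ b % d
%≡%⇒%≡%-divisor {d} {n} a b d∣n a≡b = begin
  a % d      ≡⟨ m∣n⇒o%n%m≡o%m d n a d∣n ⟨
  a % n % d  ≡⟨ ≡.cong (_% d) a≡b ⟩
  b % n % d  ≡⟨ m∣n⇒o%n%m≡o%m d n b d∣n ⟩
  b % d      ∎
  where open ≡.≡-Reasoning

module Powers {c ℓ : Level} (G : Group c ℓ) where
  open Group G
  open import Algebra.Properties.Group G using (identityʳ-unique; inverseʳ-unique)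
  import Algebra.Properties.Monoid.Mult monoid as Mult
  open import Relation.Binary.Reasoning.Setoid setoid

  infixr 8 _^_

  _^_ : Carrier → ℕ → Carrier
  _^_ = pow G

  ^≡× : ∀ x k → x ^ k ≡ k Mult.× x
  ^≡× x zero    = ≡.refl
  ^≡× x (suc k) = ≡.cong (x ∙_) (^≡× x k)

  ^-congˡ : ∀ {x y} k → x ≈ y → x ^ k ≈ y ^ k
  ^-congˡ {x} {y} k x≈y rewrite ^≡× x k | ^≡× y k = Mult.×-congʳ k x≈y

  ^-homo-∙ : ∀ x a b → x ^ (a + b) ≈ x ^ a ∙ x ^ b
  ^-homo-∙ x a b rewrite ^≡× x (a + b) | ^≡× x a | ^≡× x b = Mult.×-homo-+ x a b

  ^-assocʳ : ∀ x a b → (x ^ a) ^ b ≈ x ^ (b * a)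
  ^-assocʳ x a b rewrite ^≡× (x ^ a) b | ^≡× x a | ^≡× x (b * a) = Mult.×-assocˡ x b a

  ε^k≈ε : ∀ k → ε ^ k ≈ ε
  ε^k≈ε zero    = refl
  ε^k≈ε (suc k) = trans (identityˡ _) (ε^k≈ε k)

  ^≈^⇒^[∸]≈ε : ∀ x {a b} → a ≤ b → x ^ a ≈ x ^ b → x ^ (b ∸ a) ≈ ε
  ^≈^⇒^[∸]≈ε x {a} {b} a≤b xᵃ≈xᵇ = identityʳ-unique (x ^ a) _ (begin
    x ^ a ∙ x ^ (b ∸ a) ≈⟨ ^-homo-∙ x a (b ∸ a) ⟨
    x ^ (a + (b ∸ a))   ≡⟨ ≡.cong (x ^_) (m+[n∸m]≡n a≤b) ⟩
    x ^ b               ≈⟨ xᵃ≈xᵇ ⟨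
    x ^ a               ∎)

  module _ {x : Carrier} {m : ℕ} .{{_ : NonZero m}} (xᵐ≈ε : x ^ m ≈ ε) where

    ^[k+qm]≈^k : ∀ k q → x ^ (k + q * m) ≈ x ^ k
    ^[k+qm]≈^k k q = begin
      x ^ (k + q * m)       ≈⟨ ^-homo-∙ x k (q * m) ⟩
      x ^ k ∙ x ^ (q * m)   ≈⟨ ∙-congˡ (^-assocʳ x m q) ⟨
      x ^ k ∙ (x ^ m) ^ q   ≈⟨ ∙-congˡ (^-congˡ q xᵐ≈ε) ⟩
      x ^ k ∙ ε ^ q         ≈⟨ ∙-congˡ (ε^k≈ε q) ⟩
      x ^ k ∙ ε             ≈⟨ identityʳ (x ^ k) ⟩
      x ^ k                 ∎

    ^≈^% : ∀ k → x ^ k ≈ x ^ (k % m)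
    ^≈^% k = begin
      x ^ k                     ≡⟨ ≡.cong (x ^_) (m≡m%n+[m/n]*n k m) ⟩
      x ^ (k % m + k / m * m)   ≈⟨ ^[k+qm]≈^k (k % m) (k / m) ⟩
      x ^ (k % m)               ∎

    ⁻¹≈^pred : x ⁻¹ ≈ x ^ pred m
    ⁻¹≈^pred = sym (inverseʳ-unique x (x ^ pred m)
      (trans (reflexive (≡.cong (x ^_) (suc-pred m))) xᵐ≈ε))

    Generates⇒powers-cover : Generates G x → ∀ y → ∃ λ k → y ≈ x ^ k
    Generates⇒powers-cover gen y with gen y
    ... | k , inj₁ y≈xᵏ = k , y≈xᵏ
    ... | k , inj₂ y≈x⁻ᵏ = k * pred m , (begin
      y                 ≈⟨ y≈x⁻ᵏ ⟩
      (x ⁻¹) ^ k        ≈⟨ ^-congˡ k ⁻¹≈^pred ⟩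
      (x ^ pred m) ^ k  ≈⟨ ^-assocʳ x (pred m) k ⟩
      x ^ (k * pred m)  ∎)

    Generates⇒residues-cover : Generates G x → ∀ y → ∃ λ (r : Fin m) → y ≈ x ^ toℕ r
    Generates⇒residues-cover gen y with k , y≈xᵏ ← Generates⇒powers-cover gen y =
      fromℕ< k%m<m , (begin
        y                        ≈⟨ y≈xᵏ ⟩
        x ^ k                    ≈⟨ ^≈^% k ⟩
        x ^ (k % m)              ≡⟨ ≡.cong (x ^_) (toℕ-fromℕ< k%m<m) ⟨
        x ^ toℕ (fromℕ< k%m<m)   ∎)
      where
      k%m<m : k % m < m
      k%m<m = m%n<n k m

module GeneratorGraph {c ℓ : Level} (G : Group c ℓ) where
  open Group G
  open Powers G

  Generates-cong : ∀ {x y} → x ≈ y → Generates G x → Generates G y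
  Generates-cong x≈y gen z with gen z
  ... | k , inj₁ z≈xᵏ  = k , inj₁ (trans z≈xᵏ (^-congˡ k x≈y))
  ... | k , inj₂ z≈x⁻ᵏ = k , inj₂ (trans z≈x⁻ᵏ (^-congˡ k (⁻¹-cong x≈y)))

  edge : ∀ {x y} → Adj G x y → Walk G x y 1
  edge x~y = step x~y (stop refl)

  distinct⇒1≤length : ∀ {x y} → ¬ x ≈ y → ∀ k → Walk G x y k → 1 ≤ k
  distinct⇒1≤length x≉y _ (stop x≈y)  = contradiction x≈y x≉y
  distinct⇒1≤length x≉y _ (step _ _)  = s≤s z≤n

  nonadjacent⇒2≤length : ∀ {x y} → ¬ x ≈ y → ¬ Generates G x → ¬ Generates G y →
                         ∀ k → Walk G x y k → 2 ≤ k
  nonadjacent⇒2≤length x≉y _ _ _ (stop x≈y) = contradiction x≈y x≉y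
  nonadjacent⇒2≤length _ ¬gen-x _ _ (step (_ , inj₁ gen-x) (stop _)) = contradiction gen-x ¬gen-x
  nonadjacent⇒2≤length _ _ ¬gen-y _ (step (_ , inj₂ gen-z) (stop z≈y)) =
    contradiction (Generates-cong z≈y gen-z) ¬gen-y
  nonadjacent⇒2≤length _ _ _ _ (step _ (step _ _)) = s≤s (s≤s z≤n)

  module _ (_≈?_ : Decidable _≈_) where

    nonidentity-Generates⇒walk≤1 : (∀ x → ¬ x ≈ ε → Generates G x) →
                                   ∀ x y → ∃ λ k → k ≤ 1 × Walk G x y k
    nonidentity-Generates⇒walk≤1 gen x y with x ≈? y | x ≈? ε
    ... | yes x≈y | _     = 0 , z≤n , stop x≈y
    ... | no x≉y | no x≉ε = 1 , s≤s z≤n , edge (x≉y , inj₁ (gen x x≉ε))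
    ... | no x≉y | yes x≈ε = 1 , s≤s z≤n , edge (x≉y , inj₂ (gen y (x≉y ∘ trans x≈ε ∘ sym)))

    Generates⇒walk≤2 : ∀ {g} → Generates G g → ∀ x y → ∃ λ k → k ≤ 2 × Walk G x y k
    Generates⇒walk≤2 {g} gen-g x y with x ≈? y | x ≈? g | y ≈? g
    ... | yes x≈y | _       | _       = 0 , z≤n , stop x≈y
    ... | no x≉y  | yes x≈g | _       = 1 , s≤s z≤n , edge (x≉y , inj₁ (Generates-cong (sym x≈g) gen-g))
    ... | no x≉y  | no _    | yes y≈g = 1 , s≤s z≤n , edge (x≉y , inj₂ (Generates-cong (sym y≈g) gen-g))
    ... | no _    | no x≉g  | no y≉g  =
      2 , s≤s (s≤s z≤n) , step (x≉g , inj₂ gen-g) (edge (y≉g ∘ sym , inj₁ gen-g))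

module FiniteGroup {c ℓ : Level} (G : Group c ℓ) {n : ℕ} (order : HasOrder G n) where
  open Group G
  open Powers G

  private
    e : Fin n → Carrier
    e = proj₁ order

    e-injective : ∀ i j → e i ≈ e j → i ≡ j
    e-injective = proj₁ (proj₂ order)

    index : Carrier → Fin n
    index x = proj₁ (proj₂ (proj₂ order) x)

    e∘index : ∀ x → e (index x) ≈ x
    e∘index x = proj₂ (proj₂ (proj₂ order) x)

  instance
    order-nonZero : NonZero n
    order-nonZero = nonZeroIndex (index ε)

  _≈?_ : Decidable _≈_
  x ≈? y with index x Fin.≟ index y
  ... | yes same = yes (trans (sym (e∘index x)) (trans (reflexive (≡.cong e same)) (e∘index y)))
  ... | no differ = no λ x≈y → differ (e-injective _ _
          (trans (e∘index x) (trans x≈y (sym (e∘index y)))))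

  covered⇒order≤ : ∀ {m} (h : Fin m → Carrier) → (∀ y → ∃ λ r → y ≈ h r) → n ≤ m
  covered⇒order≤ h cover = injective⇒≤ {f = preimage} preimage-injective
    where
    preimage : Fin n → Fin _
    preimage i = proj₁ (cover (e i))

    preimage-injective : ∀ {i j} → preimage i ≡ preimage j → i ≡ j
    preimage-injective {i} {j} same = e-injective i j (trans (proj₂ (cover (e i)))
      (trans (reflexive (≡.cong h same)) (sym (proj₂ (cover (e j))))))

  ∃^≈ε : ∀ x → ∃ λ m → 0 < m × m ≤ n × x ^ m ≈ ε
  ∃^≈ε x with i , j , i<j , same ← pigeonhole (n<1+n n) (λ (i : Fin (suc n)) → index (x ^ toℕ i)) =
    toℕ j ∸ toℕ i , m<n⇒0<n∸m i<j , ≤-trans (m∸n≤m (toℕ j) (toℕ i)) (toℕ≤pred[n] j) ,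
    ^≈^⇒^[∸]≈ε x (<⇒≤ i<j)
      (trans (sym (e∘index _)) (trans (reflexive (≡.cong e same)) (e∘index _)))

module FiniteCyclic {c ℓ : Level} (G : Group c ℓ) {n : ℕ} (order : HasOrder G n)
                   {g : Group.Carrier G} (g-generates : Generates G g) where
  open Group G
  open import Algebra.Properties.Group G using (inverseˡ-unique)
  open import Relation.Binary.Reasoning.Setoid setoid
  open Powers G
  open FiniteGroup G order
  open GeneratorGraph G

  ^≈ε⇒order≤ : ∀ {m} .{{_ : NonZero m}} → g ^ m ≈ ε → n ≤ m
  ^≈ε⇒order≤ gᵐ≈ε = covered⇒order≤ (λ r → g ^ toℕ r) (Generates⇒residues-cover gᵐ≈ε g-generates)

  -- Opaque because with-abstraction over terms mentioning this proof would
  -- otherwise normalise the pigeonhole argument and exhaust memory.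
  opaque
    g^n≈ε : g ^ n ≈ ε
    g^n≈ε with m , 0<m , m≤n , gᵐ≈ε ← ∃^≈ε g =
      ≡.subst (λ k → g ^ k ≈ ε) (≤-antisym m≤n (^≈ε⇒order≤ {{>-nonZero 0<m}} gᵐ≈ε)) gᵐ≈ε

  ^n≈ε : ∀ x → x ^ n ≈ ε
  ^n≈ε x with k , x≈gᵏ ← Generates⇒powers-cover g^n≈ε g-generates x = begin
    x ^ n            ≈⟨ ^-congˡ n x≈gᵏ ⟩
    (g ^ k) ^ n      ≈⟨ ^-assocʳ g k n ⟩
    g ^ (n * k)      ≡⟨ ≡.cong (g ^_) (*-comm n k) ⟩
    g ^ (0 + k * n)  ≈⟨ ^[k+qm]≈^k g^n≈ε 0 k ⟩
    ε                ∎

  ^≈ε⇒≡0 : ∀ {k} → k < n → g ^ k ≈ ε → k ≡ 0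
  ^≈ε⇒≡0 {zero}  _   _     = ≡.refl
  ^≈ε⇒≡0 {suc k} k<n gᵏ≈ε = contradiction (^≈ε⇒order≤ gᵏ≈ε) (<⇒≱ k<n)

  ^-injective-below-order≤ : ∀ {a b} → a ≤ b → b < n → g ^ a ≈ g ^ b → a ≡ b
  ^-injective-below-order≤ {a} {b} a≤b b<n gᵃ≈gᵇ = ≤-antisym a≤b (m∸n≡0⇒m≤n
    (^≈ε⇒≡0 (≤-<-trans (m∸n≤m b a) b<n) (^≈^⇒^[∸]≈ε g a≤b gᵃ≈gᵇ)))

  ^-injective-below-order : ∀ {r s} → r < n → s < n → g ^ r ≈ g ^ s → r ≡ s
  ^-injective-below-order {r} {s} r<n s<n gʳ≈gˢ with ≤-total r s
  ... | inj₁ r≤s = ^-injective-below-order≤ r≤s s<n gʳ≈gˢ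
  ... | inj₂ s≤r = ≡.sym (^-injective-below-order≤ s≤r r<n (sym gʳ≈gˢ))

  ^≈^⇒%≡% : ∀ {a b} → g ^ a ≈ g ^ b → a % n ≡ b % n
  ^≈^⇒%≡% {a} {b} gᵃ≈gᵇ = ^-injective-below-order (m%n<n a n) (m%n<n b n)
    (trans (sym (^≈^% g^n≈ε a)) (trans gᵃ≈gᵇ (^≈^% g^n≈ε b)))

  g≉ε : 1 < n → ¬ g ≈ ε
  g≉ε 1<n g≈ε with () ← ^≈ε⇒≡0 1<n (trans (identityʳ g) g≈ε)

  root⇒Generates : ∀ {x} k → g ≈ x ^ k → Generates G x
  root⇒Generates {x} k g≈xᵏ y with j , y≈gʲ ← Generates⇒powers-cover g^n≈ε g-generates y =
    j * k , inj₁ (begin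
      y            ≈⟨ y≈gʲ ⟩
      g ^ j        ≈⟨ ^-congˡ j g≈xᵏ ⟩
      (x ^ k) ^ j  ≈⟨ ^-assocʳ x k j ⟩
      x ^ (j * k)  ∎)

  coprime⇒Generates : ∀ {x r} → Coprime r n → x ≈ g ^ r → Generates G x
  coprime⇒Generates {x} {r} r⊥n x≈gʳ with coprime-Bézout r⊥n
  ... | Bézout.+- a b 1+bn≡ar = root⇒Generates a (begin
    g                ≈⟨ identityʳ g ⟨
    g ^ 1            ≈⟨ ^[k+qm]≈^k g^n≈ε 1 b ⟨
    g ^ (1 + b * n)  ≡⟨ ≡.cong (g ^_) 1+bn≡ar ⟩
    g ^ (a * r)      ≈⟨ ^-assocʳ g r a ⟨
    (g ^ r) ^ a      ≈⟨ ^-congˡ a x≈gʳ ⟨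
    x ^ a            ∎)
  ... | Bézout.-+ a b 1+ar≡bn = root⇒Generates (pred n * a) (begin
    g                 ≈⟨ inverseˡ-unique g (x ^ a) g∙xᵃ≈ε ⟩
    (x ^ a) ⁻¹        ≈⟨ ⁻¹≈^pred {m = n} (^n≈ε (x ^ a)) ⟩
    (x ^ a) ^ pred n  ≈⟨ ^-assocʳ x a (pred n) ⟩
    x ^ (pred n * a)  ∎)
    where
    g∙xᵃ≈ε : g ∙ x ^ a ≈ ε
    g∙xᵃ≈ε = begin
      g ∙ x ^ a          ≈⟨ ∙-congˡ (^-congˡ a x≈gʳ) ⟩
      g ∙ (g ^ r) ^ a    ≈⟨ ∙-congˡ (^-assocʳ g r a) ⟩
      g ^ (1 + a * r)    ≡⟨ ≡.cong (g ^_) 1+ar≡bn ⟩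
      g ^ (0 + b * n)    ≈⟨ ^[k+qm]≈^k g^n≈ε 0 b ⟩
      ε                  ∎

  prime⇒nonidentity-Generates : Prime n → ∀ x → ¬ x ≈ ε → Generates G x
  prime⇒nonidentity-Generates p x x≉ε with Generates⇒residues-cover g^n≈ε g-generates x
  ... | zero  , x≈ε  = contradiction x≈ε x≉ε
  ... | suc r , x≈gʳ = coprime⇒Generates (Coprimality.sym (prime⇒coprime p (toℕ<n (suc r)))) x≈gʳ

  divisor-power-¬Generates : ∀ {d m} .{{_ : NonTrivial d}} → d ∣ n → d ∣ m → ¬ Generates G (g ^ m)
  divisor-power-¬Generates {d} {m} d∣n d∣m gen
    with k , g≈gᵐᵏ ← Generates⇒powers-cover {m = n} (^n≈ε (g ^ m)) gen g = contradiction 1≡0 λ ()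
    where
    instance
      d-nonZero : NonZero d
      d-nonZero = nonTrivial⇒nonZero d

    1%n≡km%n : 1 % n ≡ (k * m) % n
    1%n≡km%n = ^≈^⇒%≡% (trans (identityʳ g) (trans g≈gᵐᵏ (^-assocʳ g m k)))

    1≡0 : 1 ≡ 0
    1≡0 = ≡.trans (≡.sym (m<n⇒m%n≡m (nonTrivial⇒n>1 d)))
      (≡.trans (%≡%⇒%≡%-divisor 1 (k * m) d∣n 1%n≡km%n) (n∣m⇒m%n≡0 (k * m) d (∣n⇒∣m*n k d∣m)))

  prime⇒Diameter1 : 1 < n → Prime n → Diameter G 1
  prime⇒Diameter1 1<n p =
    nonidentity-Generates⇒walk≤1 _≈?_ (prime⇒nonidentity-Generates p) ,
    ε , g , distinct⇒1≤length (g≉ε 1<n ∘ sym)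

  composite⇒Diameter2 : ∀ {d} .{{_ : NonTrivial d}} → d < n → d ∣ n → Diameter G 2
  composite⇒Diameter2 {d} d<n d∣n =
    Generates⇒walk≤2 _≈?_ g-generates ,
    ε , g ^ d , nonadjacent⇒2≤length ε≉gᵈ
                  (divisor-power-¬Generates d∣n (d ∣0))
                  (divisor-power-¬Generates d∣n ∣-refl)
    where
    ε≉gᵈ : ¬ ε ≈ g ^ d
    ε≉gᵈ ε≈gᵈ = contradiction (^≈ε⇒≡0 d<n (sym ε≈gᵈ)) (≢-nonZero⁻¹ d {{nonTrivial⇒nonZero d}})

corollary3p9 : ∀ {c ℓ : Level} (G : Group c ℓ) (n : ℕ) →
    2 ≤ n → HasOrder G n → Cyclic G →
    (Prime n → Diameter G 1) × (¬ Prime n → Diameter G 2)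
corollary3p9 G n 2≤n order (g , g-generates) = prime⇒Diameter1 2≤n , composite-case
  where
  open FiniteCyclic G order g-generates

  composite-case : ¬ Prime n → Diameter G 2
  composite-case ¬prime with composite d<n d∣n ← ¬prime⇒composite {{n>1⇒nonTrivial 2≤n}} ¬prime =
    composite⇒Diameter2 d<n d∣n
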